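{- Let $(X,\mathcal{T}_X)$ be a space which is overt (as a subset of itself) and is a Spreen space, and let $(Y,\mathcal{T}_Y)$ be a (pointwise) regular space. Then every map $f : X \to Y$ (an arbitrary function, not assumed continuous) is pointwise continuous.
   Context: We work constructively, in higher-order intuitionistic logic with Dependent Choice (hence Countable Choice). $\Omega$ is the set of truth values. The Rosolini dominance is $\Sigma = \{p \in \Omega \mid \exists f \in 2^{\mathbb{N}}\, (p \Leftrightarrow \exists n \in \mathbb{N}\, f(n)=1)\}$; its elements are the semidecidable truth values, and the semidecidable subsets of a set $X$ are the maps $X \to \Sigma$ (identified with subsets of $X$). A subset $T \subseteq X$ is overt if for every $\phi : X \to \Sigma$ the truth value $\exists x \in T\, \phi(x)$ belongs to $\Sigma$; $X$ is overt if it is overt as a subset of itself. A countable set is one admitting a surjection $\mathbb{N} \to \{\star\} + I$. A space $(X,\mathcal{T})$ is a set $X$ with a (Malcev) topology $\mathcal{T}$: a collection of semidecidable subsets of $X$ closed under finite intersections (including $X$ itself) and unions of countably-indexed families; its members are called open. A space $(X,\mathcal{T})$ is (pointwise) regular if whenever $x \in U \in \mathcal{T}$ there are disjoint $S, T \in \mathcal{T}$ with $x \in S \subseteq U$ and $T \cup U = X$. A space $(X,\mathcal{T})$ is a Spreen space if whenever $T \subseteq X$ is overt, $S \subseteq X$ is semidecidable, $S \cap T = \emptyset$ and $x \in S$, there is $U \in \mathcal{T}$ with $x \in U$ and $U \cap T = \emptyset$. A subset $V$ of a space is pointwise open if for every $y \in V$ there is an open set $W$ with $y \in W \subseteq V$.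 A map $f : X \to Y$ between spaces is pointwise continuous if $f^{ -1}(V)$ is pointwise open in $X$ for every pointwise open $V \subseteq Y$. -}

module Defs where

open import Data.Nat using (ℕ)
open import Data.Bool using (Bool; true)
open import Data.Product using (Σ; ∃; _×_; _,_; Σ-syntax; ∃-syntax)
open import Data.Sum using (_⊎_)
open import Data.Unit using (⊤)
open import Data.Empty using (⊥)
open import Relation.Binary.PropositionalEquality using (_≡_)
open import Function.Bundles using (_⇔_)

-- Propositions-as-types reading of the paper's higher-order logic:
-- truth values are types in Set, subsets of X are predicates X → Set.

-- p ∈ Σ (Rosolini dominance): there is f : ℕ → 2 with p ⇔ ∃ n. f n = 1
IsSemidecidable : Set → Set
IsSemidecidable p = Σ[ f ∈ (ℕ → Bool) ] (p ⇔ (∃[ n ] f n ≡ true))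

Subset : Set → Set₁
Subset X = X → Set

SemidecidableSubset : {X : Set} → Subset X → Set
SemidecidableSubset {X} S = (x : X) → IsSemidecidable (S x)

_⊆_ : {X : Set} → Subset X → Subset X → Set
_⊆_ {X} S T = (x : X) → S x → T x

_∩_ : {X : Set} → Subset X → Subset X → Subset X
(S ∩ T) x = S x × T x

Disjoint : {X : Set} → Subset X → Subset X → Set
Disjoint {X} S T = (x : X) → S x → T x → ⊥

Full : (X : Set) → Subset X
Full X x = ⊤

IsOvert : {X : Set} → Subset X → Set₁
IsOvert {X} T = (φ : Subset X) → SemidecidableSubset φ → IsSemidecidable (∃[ x ] (T x × φ x))

Countable : Set → Set
Countable I = Σ[ e ∈ (ℕ → ⊤ ⊎ I) ] ((y : ⊤ ⊎ I) → ∃[ n ] e n ≡ y)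

-- Malcev topology on X, given as a predicate "is open" on subsets of X
record IsTopology (X : Set) (Open : Subset X → Set) : Set₁ where
  field
    open-semidec : (U : Subset X) → Open U → SemidecidableSubset U
    -- membership respects extensional equality of subsets (subsets are sets)
    open-ext : (U V : Subset X) → U ⊆ V → V ⊆ U → Open U → Open V
    open-full : Open (Full X)
    open-∩ : (U V : Subset X) → Open U → Open V → Open (U ∩ V)
    open-⋃ : (I : Set) → Countable I → (U : I → Subset X) →
             ((i : I) → Open (U i)) → Open (λ x → ∃[ i ] U i x)

record Space : Set₁ where
  field
    Carrier : Set
    Open : Subset Carrier → Set
    isTopology : IsTopology Carrier Open

open Space public

IsRegular : Space → Set₁
IsRegular X = (x : Carrier X) (U : Subset (Carrier X)) → Open X U → U x →
  Σ[ S ∈ Subset (Carrier X) ] Σ[ T ∈ Subset (Carrier X) ]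
    (Open X S × Open X T × Disjoint S T × S x × S ⊆ U ×
     ((y : Carrier X) → T y ⊎ U y))

IsSpreen : Space → Set₁
IsSpreen X = (T S : Subset (Carrier X)) (x : Carrier X) →
  IsOvert T → SemidecidableSubset S → Disjoint S T → S x →
  Σ[ U ∈ Subset (Carrier X) ] (Open X U × U x × Disjoint U T)

PointwiseOpen : (X : Space) → Subset (Carrier X) → Set₁
PointwiseOpen X V = (y : Carrier X) → V y →
  Σ[ W ∈ Subset (Carrier X) ] (Open X W × W y × W ⊆ V)

PointwiseContinuous : (X Y : Space) → (Carrier X → Carrier Y) → Set₁
PointwiseContinuous X Y f = (V : Subset (Carrier Y)) → PointwiseOpen Y V →
  PointwiseOpen X (λ x → V (f x))

{-# OPTIONS --safe #-}
-- Given x with f x in a pointwise open V, pick an open W with f x ∈ W ⊆ V and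
-- use regularity of Y to split it into disjoint opens S ∋ f x and T with
-- T ∪ W = Y. Since X is overt, the semidecidable set f⁻¹ T is overt, and it is
-- disjoint from the semidecidable set f⁻¹ S ∋ x. The Spreen property then gives
-- an open U ∋ x missing f⁻¹ T, hence U ⊆ f⁻¹ W ⊆ f⁻¹ V.
module Submission where

open import Defs
open import Data.Nat using (ℕ; zero; suc; _⊔_; _≤′_; ≤′-refl; ≤′-step)
open import Data.Nat.Properties using (≤⇒≤′; m≤m⊔n; m≤n⊔m)
open import Data.Bool using (Bool; true; false; _∨_; _∧_)
open import Data.Bool.Properties using (∨-zeroʳ; ∧-conicalˡ; ∧-conicalʳ)
open import Data.Product using (_×_; _,_; Σ-syntax; ∃-syntax)
open import Data.Sum using (inj₁; inj₂)
open import Data.Unit using (tt)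
open import Data.Empty using (⊥-elim)
open import Relation.Binary.PropositionalEquality using (_≡_; cong; cong₂; trans)
open import Function.Bundles using (mk⇔; Equivalence)

module _ (f : ℕ → Bool) where

  anyUpTo : ℕ → Bool
  anyUpTo zero    = f zero
  anyUpTo (suc n) = anyUpTo n ∨ f (suc n)

  anyUpTo-sound : ∀ n → anyUpTo n ≡ true → ∃[ i ] f i ≡ true
  anyUpTo-sound zero    e = zero , e
  anyUpTo-sound (suc n) e with anyUpTo n in eq
  ... | true  = anyUpTo-sound n eq
  ... | false = suc n , e

  anyUpTo-complete : ∀ i → f i ≡ true → anyUpTo i ≡ true
  anyUpTo-complete zero    e = e
  anyUpTo-complete (suc i) e = trans (cong (anyUpTo i ∨_) e) (∨-zeroʳ (anyUpTo i))

  anyUpTo-mono : ∀ {m n} → m ≤′ n → anyUpTo m ≡ true → anyUpTo n ≡ true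
  anyUpTo-mono ≤′-refl               e = e
  anyUpTo-mono (≤′-step {n = n} m≤n) e = cong (_∨ f (suc n)) (anyUpTo-mono m≤n e)

-- The witnesses of p and q appear at different stages; the running
-- disjunctions anyUpTo make both visible from the later stage on.
semidecidable-× : ∀ {p q} → IsSemidecidable p → IsSemidecidable q → IsSemidecidable (p × q)
semidecidable-× {p} {q} (f , p⇔f) (g , q⇔g) = h , mk⇔ to from
  where
  h : ℕ → Bool
  h n = anyUpTo f n ∧ anyUpTo g n

  to : p × q → ∃[ n ] h n ≡ true
  to (a , b) with Equivalence.to p⇔f a | Equivalence.to q⇔g b
  ... | i , fi | j , gj =
    i ⊔ j , cong₂ _∧_ (anyUpTo-mono f (≤⇒≤′ (m≤m⊔n i j)) (anyUpTo-complete f i fi))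
                      (anyUpTo-mono g (≤⇒≤′ (m≤n⊔m i j)) (anyUpTo-complete g j gj))

  from : ∃[ n ] h n ≡ true → p × q
  from (n , e) =
    Equivalence.from p⇔f (anyUpTo-sound f n (∧-conicalˡ _ _ e)) ,
    Equivalence.from q⇔g (anyUpTo-sound g n (∧-conicalʳ _ _ e))

semidecidable-resp-⇔ : ∀ {p q} → (p → q) → (q → p) → IsSemidecidable p → IsSemidecidable q
semidecidable-resp-⇔ p→q q→p (f , p⇔f) =
  f , mk⇔ (λ b → Equivalence.to p⇔f (q→p b)) (λ e → p→q (Equivalence.from p⇔f e))

overt-∩-semidecidable : {X : Set} {T S : Subset X} →
  IsOvert T → SemidecidableSubset S → IsOvert (T ∩ S)
overt-∩-semidecidable T-overt S-semidec φ φ-semidec =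
  semidecidable-resp-⇔ (λ { (x , t , s , φx) → x , (t , s) , φx })
                       (λ { (x , (t , s) , φx) → x , t , s , φx })
                       (T-overt (_ ∩ φ) (λ x → semidecidable-× (S-semidec x) (φ-semidec x)))

open-preimage-semidecidable : {A : Set} (Y : Space) (f : A → Carrier Y) {W : Subset (Carrier Y)} →
  Open Y W → SemidecidableSubset (λ a → W (f a))
open-preimage-semidecidable Y f {W} W-open a = IsTopology.open-semidec (isTopology Y) W W-open (f a)

open-nbhd-in-preimage : (X Y : Space) → IsOvert (Full (Carrier X)) → IsSpreen X → IsRegular Y →
  (f : Carrier X → Carrier Y) (x : Carrier X) (W : Subset (Carrier Y)) → Open Y W → W (f x) →
  Σ[ U ∈ Subset (Carrier X) ] (Open X U × U x × U ⊆ (λ x′ → W (f x′)))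
open-nbhd-in-preimage X Y X-overt X-spreen Y-regular f x W W-open fx∈W
  with Y-regular (f x) W W-open fx∈W
... | S , T , S-open , T-open , S∩T=∅ , fx∈S , _ , T∪W=Y
  with X-spreen (Full (Carrier X) ∩ (λ x′ → T (f x′))) (λ x′ → S (f x′)) x
         (overt-∩-semidecidable X-overt (open-preimage-semidecidable Y f T-open))
         (open-preimage-semidecidable Y f S-open)
         (λ x′ s (_ , t) → S∩T=∅ (f x′) s t)
         fx∈S
... | U , U-open , x∈U , U∩f⁻¹T=∅ = U , U-open , x∈U , U⊆f⁻¹W
  where
  U⊆f⁻¹W : U ⊆ (λ x′ → W (f x′))
  U⊆f⁻¹W x′ u with T∪W=Y (f x′)
  ... | inj₁ t = ⊥-elim (U∩f⁻¹T=∅ x′ u (tt , t))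
  ... | inj₂ w = w

theorem3p17 : (X Y : Space) → IsOvert (Full (Carrier X)) → IsSpreen X → IsRegular Y →
    (f : Carrier X → Carrier Y) → PointwiseContinuous X Y f
theorem3p17 X Y X-overt X-spreen Y-regular f V V-pointwise-open x fx∈V
  with V-pointwise-open (f x) fx∈V
... | W , W-open , fx∈W , W⊆V
  with open-nbhd-in-preimage X Y X-overt X-spreen Y-regular f x W W-open fx∈W
... | U , U-open , x∈U , U⊆f⁻¹W = U , U-open , x∈U , λ x′ u → W⊆V (f x′) (U⊆f⁻¹W x′ u)
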